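{- Let $K=\mathbf{F}_2(x)$ and $A=K[Y]/(Y^4+xY+x^4)$ with $y$ the image of $Y$; for $k\in\mathbf{Z}$ let $P_k(x)=\mathrm{Tr}_{A/K}(y^k)\in K$ (trace of multiplication by $y^k$). For $n\ge0$ let $a_n=\frac{4^n-1}{3}$, $Q_0=0$ and $Q_n(x)=\sum_{i=1}^n x^{(a_i+3)4^{n-i}}$. Then for all $n\ge0$ and $k\in\mathbf{Z}$, $$P_{4^n+k}=Q_nP_k+x^{a_n}P_{k+1},\qquad P_{2\cdot4^n+k}=Q_n^2P_k+x^{2a_n}P_{k+2}.$$
   Context: Here $y$ is invertible in $A$ since $y(y^3+x)=x^4$. For $k\ge0$, $P_k(\Delta)=T_3|\Delta^k$ (reduction mod 2 of $\Delta$, Hecke operator $T_3$), but this identification is not needed for the statement. -}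

module Defs where

open import Data.Bool using (Bool; true; false; _xor_; _∧_)
open import Data.List using (List; []; _∷_; map; replicate; _++_)
open import Data.Nat using (ℕ; zero; suc; _+_; _*_; _∸_; _^_)
open import Data.Nat.DivMod using (_/_)
open import Data.Integer using (ℤ; +_; -[1+_])
open import Relation.Binary.PropositionalEquality using (_≡_)

-- Polynomials over F₂ = Bool (xor, ∧), coefficient lists, lowest degree first.

Poly : Set
Poly = List Bool

addP : Poly → Poly → Poly
addP [] q = q
addP (a ∷ p) [] = a ∷ p
addP (a ∷ p) (b ∷ q) = (a xor b) ∷ addP p q

scaleP : Bool → Poly → Poly
scaleP b = map (b ∧_)

mulP : Poly → Poly → Poly
mulP [] q = []
mulP (a ∷ p) q = addP (scaleP a q) (false ∷ mulP p q)

shiftP : ℕ → Poly → Poly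
shiftP n p = replicate n false ++ p

coeff : Poly → ℕ → Bool
coeff [] _ = false
coeff (a ∷ p) zero = a
coeff (a ∷ p) (suc i) = coeff p i

_≈P_ : Poly → Poly → Set
p ≈P q = ∀ i → coeff p i ≡ coeff q i

-- Laurent polynomials F₂[x, x⁻¹] ⊂ K = F₂(x):  mkL n p  represents  x^(-n) · p.

record Laurent : Set where
  constructor mkL
  field
    den : ℕ
    num : Poly
open Laurent public

infixl 6 _⊕_
infixl 7 _⊛_
infix 4 _≈_

_⊕_ : Laurent → Laurent → Laurent
mkL m p ⊕ mkL n q = mkL (m + n) (addP (shiftP n p) (shiftP m q))

_⊛_ : Laurent → Laurent → Laurent
mkL m p ⊛ mkL n q = mkL (m + n) (mulP p q)

-- equality in K:  x^(-m) p = x^(-n) q  iff  x^n p = x^m q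
_≈_ : Laurent → Laurent → Set
mkL m p ≈ mkL n q = shiftP n p ≈P shiftP m q

0L 1L : Laurent
0L = mkL 0 []
1L = mkL 0 (true ∷ [])

xpow : ℕ → Laurent
xpow m = mkL 0 (shiftP m (true ∷ []))

xinv : ℕ → Laurent
xinv m = mkL m (true ∷ [])

-- The algebra A = K[Y]/(Y⁴ + xY + x⁴), elements written in the K-basis
-- 1, y, y², y³ (coefficients in F₂[x,x⁻¹], which suffices for all elements used).

record A : Set where
  constructor mkA
  field
    c0 c1 c2 c3 : Laurent
open A public

addA : A → A → A
addA (mkA a0 a1 a2 a3) (mkA b0 b1 b2 b3) = mkA (a0 ⊕ b0) (a1 ⊕ b1) (a2 ⊕ b2) (a3 ⊕ b3)

scaleA : Laurent → A → A
scaleA c (mkA a0 a1 a2 a3) = mkA (c ⊛ a0) (c ⊛ a1) (c ⊛ a2) (c ⊛ a3)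

-- multiplication by y, using y⁴ = xy + x⁴ (characteristic 2)
mulY : A → A
mulY (mkA a0 a1 a2 a3) = mkA (xpow 4 ⊛ a3) (a0 ⊕ xpow 1 ⊛ a3) a1 a2

mulA : A → A → A
mulA (mkA a0 a1 a2 a3) b =
  addA (addA (scaleA a0 b) (scaleA a1 (mulY b)))
       (addA (scaleA a2 (mulY (mulY b))) (scaleA a3 (mulY (mulY (mulY b)))))

oneA yA : A
oneA = mkA 1L 0L 0L 0L
yA   = mkA 0L 1L 0L 0L

-- y⁻¹ = x⁻⁴ (y³ + x) = x⁻³ + x⁻⁴ y³   (since y (y³ + x) = x⁴)
yinvA : A
yinvA = mkA (xinv 3) 0L 0L (xinv 4)

powA : A → ℕ → A
powA a zero = oneA
powA a (suc n) = mulA a (powA a n)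

ypow : ℤ → A
ypow (+ n) = powA yA n
ypow -[1+ n ] = powA yinvA (suc n)

-- Tr_{A/K}(a): trace of the K-linear map "multiplication by a" in the basis
-- 1, y, y², y³; the (j,j) diagonal entry is the y^j-coordinate of a·y^j.
trA : A → Laurent
trA a = c0 a ⊕ c1 (mulA a yA) ⊕ c2 (mulA a (powA yA 2)) ⊕ c3 (mulA a (powA yA 3))

P : ℤ → Laurent
P k = trA (ypow k)

aN : ℕ → ℕ
aN n = (4 ^ n ∸ 1) / 3

Qsum : ℕ → ℕ → Laurent
Qsum n zero = 0L
Qsum n (suc m) = Qsum n m ⊕ xpow ((aN (suc m) + 3) * 4 ^ (n ∸ suc m))

Q : ℕ → Laurent
Q n = Qsum n n

module Submission where

-- Let M be multiplication by y, a K-linear endomorphism of A with M⁴ = x⁴ + x M. In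
-- characteristic 2, if M^N = s + t M^j then squaring gives M^(2N) = s² + t² M^(2j), the
-- cross terms cancelling because all these maps commute. Squaring twice, induction on n
-- gives M^(4^n) = Q_n + x^(a_n) M, since Q_(n+1) = Q_n⁴ + x^(4 a_n + 4) and
-- a_(n+1) = 4 a_n + 1; squaring once more gives M^(2·4^n) = Q_n² + x^(2 a_n) M². Applying
-- these to y^k and taking the K-linear trace yields both identities.

open import Defs
open import Data.Nat using (ℕ; _*_; _^_)
open import Data.Integer using (ℤ; +_; _+_)
open import Data.Product using (_×_)

open import Algebra using (CommutativeRing; CommutativeMonoid)
open import Data.Bool using (true; false; _xor_; _∧_)
open import Data.Bool.Properties
  using (xor-same; xor-identityʳ; xor-comm; xor-assoc; ∧-zeroʳ; ∧-comm; ∧-distribʳ-xor)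
open import Data.Integer using (-[1+_])
import Data.Integer.Properties as ℤₚ
open import Data.List using ([]; _∷_)
open import Data.Maybe using (Maybe; just; nothing)
import Data.Maybe as Maybe
open import Data.Nat using (zero; suc; _∸_; _≤_)
import Data.Nat as ℕ
import Data.Nat.Properties as ℕₚ
open import Data.Nat.DivMod using (_/_; m*n/n≡m)
open import Data.Nat.GeneralisedArithmetic using (fold; fold-+)
open import Data.Nat.Tactic.RingSolver using () renaming (solve-∀ to ℕ-solve-∀)
open import Data.Product using (_,_)
open import Level using (0ℓ)
open import Relation.Binary.Bundles using (Setoid)
open import Relation.Binary.PropositionalEquality as ≡ using (_≡_; refl; cong; cong₂)
open import Relation.Binary.Structures using (IsEquivalence)
import Relation.Binary.Reasoning.Setoid as SetoidReasoning
open import Tactic.RingSolver using (solve-∀)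
open import Tactic.RingSolver.Core.AlmostCommutativeRing using (AlmostCommutativeRing; fromCommutativeRing)

-- Polynomials over F₂

infix 4 _≋_
infixl 6 _⊞_
infixl 7 _⊠_

_⊞_ _⊠_ : Poly → Poly → Poly
_⊞_ = addP
_⊠_ = mulP

-- _≈P_ as a record, so that both polynomials can be inferred from an equation.
record _≋_ (p q : Poly) : Set where
  constructor pointwise
  field coeff-≡ : p ≈P q
open _≋_

≋-isEquivalence : IsEquivalence _≋_
≋-isEquivalence = record
  { refl  = pointwise λ _ → refl
  ; sym   = λ p≋q → pointwise λ i → ≡.sym (coeff-≡ p≋q i)
  ; trans = λ p≋q q≋r → pointwise λ i → ≡.trans (coeff-≡ p≋q i) (coeff-≡ q≋r i)
  }

≋-setoid : Setoid 0ℓ 0ℓ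
≋-setoid = record { isEquivalence = ≋-isEquivalence }

open Setoid ≋-setoid public using () renaming (refl to ≋-refl; sym to ≋-sym; trans to ≋-trans)

≡⇒≋ : ∀ {p q} → p ≡ q → p ≋ q
≡⇒≋ refl = ≋-refl

coeff-addP : ∀ p q i → coeff (p ⊞ q) i ≡ coeff p i xor coeff q i
coeff-addP []      q       i       = refl
coeff-addP (a ∷ p) []      i       = ≡.sym (xor-identityʳ _)
coeff-addP (a ∷ p) (b ∷ q) zero    = refl
coeff-addP (a ∷ p) (b ∷ q) (suc i) = coeff-addP p q i

coeff-scaleP : ∀ a p i → coeff (scaleP a p) i ≡ a ∧ coeff p i
coeff-scaleP a []      i       = ≡.sym (∧-zeroʳ a)
coeff-scaleP a (b ∷ p) zero    = refl
coeff-scaleP a (b ∷ p) (suc i) = coeff-scaleP a p i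

∷-cong : ∀ {a b p q} → a ≡ b → p ≋ q → a ∷ p ≋ b ∷ q
∷-cong a≡b p≋q = pointwise λ where
  zero    → a≡b
  (suc i) → coeff-≡ p≋q i

[]≋false∷[] : [] ≋ false ∷ []
[]≋false∷[] = pointwise λ where
  zero    → refl
  (suc i) → refl

addP-cong : ∀ {p p' q q'} → p ≋ p' → q ≋ q' → p ⊞ q ≋ p' ⊞ q'
addP-cong {p} {p'} {q} {q'} p≋p' q≋q' = pointwise λ i → begin
  coeff (p ⊞ q) i           ≡⟨ coeff-addP p q i ⟩
  coeff p i xor coeff q i   ≡⟨ cong₂ _xor_ (coeff-≡ p≋p' i) (coeff-≡ q≋q' i) ⟩
  coeff p' i xor coeff q' i ≡⟨ ≡.sym (coeff-addP p' q' i) ⟩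
  coeff (p' ⊞ q') i         ∎
  where open ≡.≡-Reasoning

addP-assoc : ∀ p q r → (p ⊞ q) ⊞ r ≋ p ⊞ (q ⊞ r)
addP-assoc p q r = pointwise λ i → begin
  coeff ((p ⊞ q) ⊞ r) i                    ≡⟨ coeff-addP (p ⊞ q) r i ⟩
  coeff (p ⊞ q) i xor coeff r i            ≡⟨ cong (_xor coeff r i) (coeff-addP p q i) ⟩
  (coeff p i xor coeff q i) xor coeff r i  ≡⟨ xor-assoc (coeff p i) (coeff q i) (coeff r i) ⟩
  coeff p i xor (coeff q i xor coeff r i)  ≡⟨ cong (coeff p i xor_) (≡.sym (coeff-addP q r i)) ⟩
  coeff p i xor coeff (q ⊞ r) i            ≡⟨ ≡.sym (coeff-addP p (q ⊞ r) i) ⟩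
  coeff (p ⊞ (q ⊞ r)) i                    ∎
  where open ≡.≡-Reasoning

addP-comm : ∀ p q → p ⊞ q ≋ q ⊞ p
addP-comm p q = pointwise λ i → begin
  coeff (p ⊞ q) i         ≡⟨ coeff-addP p q i ⟩
  coeff p i xor coeff q i ≡⟨ xor-comm (coeff p i) (coeff q i) ⟩
  coeff q i xor coeff p i ≡⟨ ≡.sym (coeff-addP q p i) ⟩
  coeff (q ⊞ p) i         ∎
  where open ≡.≡-Reasoning

addP-identityʳ : ∀ p → p ⊞ [] ≋ p
addP-identityʳ p = pointwise λ i → ≡.trans (coeff-addP p [] i) (xor-identityʳ (coeff p i))

addP-self : ∀ p → p ⊞ p ≋ []
addP-self p = pointwise λ i → ≡.trans (coeff-addP p p i) (xor-same (coeff p i))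

addP-commutativeMonoid : CommutativeMonoid 0ℓ 0ℓ
addP-commutativeMonoid = record
  { _≈_ = _≋_ ; _∙_ = _⊞_ ; ε = []
  ; isCommutativeMonoid = record
    { isMonoid = record
      { isSemigroup = record
        { isMagma = record { isEquivalence = ≋-isEquivalence ; ∙-cong = addP-cong }
        ; assoc = addP-assoc }
      ; identity = (λ _ → ≋-refl) , addP-identityʳ }
    ; comm = addP-comm } }

open import Algebra.Properties.CommutativeSemigroup
  (CommutativeMonoid.commutativeSemigroup addP-commutativeMonoid)
  using (interchange; x∙yz≈y∙xz)

scaleP-cong : ∀ a {p q} → p ≋ q → scaleP a p ≋ scaleP a q
scaleP-cong a {p} {q} p≋q = pointwise λ i →
  ≡.trans (coeff-scaleP a p i) (≡.trans (cong (a ∧_) (coeff-≡ p≋q i)) (≡.sym (coeff-scaleP a q i)))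

scaleP-false : ∀ p → scaleP false p ≋ []
scaleP-false p = pointwise (coeff-scaleP false p)

scaleP-true : ∀ p → scaleP true p ≋ p
scaleP-true p = pointwise (coeff-scaleP true p)

scaleP-xor : ∀ a b p → scaleP (a xor b) p ≋ scaleP a p ⊞ scaleP b p
scaleP-xor a b p = pointwise λ i → begin
  coeff (scaleP (a xor b) p) i                    ≡⟨ coeff-scaleP (a xor b) p i ⟩
  (a xor b) ∧ coeff p i                           ≡⟨ ∧-distribʳ-xor (coeff p i) a b ⟩
  (a ∧ coeff p i) xor (b ∧ coeff p i)             ≡⟨ ≡.sym (cong₂ _xor_ (coeff-scaleP a p i) (coeff-scaleP b p i)) ⟩
  coeff (scaleP a p) i xor coeff (scaleP b p) i   ≡⟨ ≡.sym (coeff-addP (scaleP a p) (scaleP b p) i) ⟩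
  coeff (scaleP a p ⊞ scaleP b p) i               ∎
  where open ≡.≡-Reasoning

mulP-congʳ : ∀ p {q q'} → q ≋ q' → p ⊠ q ≋ p ⊠ q'
mulP-congʳ []      q≋q' = ≋-refl
mulP-congʳ (a ∷ p) q≋q' = addP-cong (scaleP-cong a q≋q') (∷-cong refl (mulP-congʳ p q≋q'))

mulP-zeroʳ : ∀ p → p ⊠ [] ≋ []
mulP-zeroʳ []      = ≋-refl
mulP-zeroʳ (a ∷ p) = ≋-trans (∷-cong refl (mulP-zeroʳ p)) (≋-sym []≋false∷[])

mulP-consʳ : ∀ p a q → p ⊠ (a ∷ q) ≋ scaleP a p ⊞ (false ∷ p ⊠ q)
mulP-consʳ []      a q = []≋false∷[]
mulP-consʳ (b ∷ p) a q = ∷-cong (cong (_xor false) (∧-comm b a)) (begin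
  scaleP b q ⊞ p ⊠ (a ∷ q)                           ≈⟨ addP-cong ≋-refl (mulP-consʳ p a q) ⟩
  scaleP b q ⊞ (scaleP a p ⊞ (false ∷ p ⊠ q))        ≈⟨ x∙yz≈y∙xz (scaleP b q) (scaleP a p) _ ⟩
  scaleP a p ⊞ (scaleP b q ⊞ (false ∷ p ⊠ q))        ∎)
  where open SetoidReasoning ≋-setoid

mulP-comm : ∀ p q → p ⊠ q ≋ q ⊠ p
mulP-comm []      q = ≋-sym (mulP-zeroʳ q)
mulP-comm (a ∷ p) q =
  ≋-trans (addP-cong ≋-refl (∷-cong refl (mulP-comm p q))) (≋-sym (mulP-consʳ q a p))

mulP-congˡ : ∀ {p p'} q → p ≋ p' → p ⊠ q ≋ p' ⊠ q
mulP-congˡ {p} {p'} q p≋p' =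
  ≋-trans (mulP-comm p q) (≋-trans (mulP-congʳ q p≋p') (mulP-comm q p'))

mulP-identityˡ : ∀ p → (true ∷ []) ⊠ p ≋ p
mulP-identityˡ p = ≋-trans (addP-cong (scaleP-true p) (≋-sym []≋false∷[])) (addP-identityʳ p)

mulP-identityʳ : ∀ p → p ⊠ (true ∷ []) ≋ p
mulP-identityʳ p = ≋-trans (mulP-comm p (true ∷ [])) (mulP-identityˡ p)

mulP-distribʳ : ∀ p q r → (p ⊞ q) ⊠ r ≋ p ⊠ r ⊞ q ⊠ r
mulP-distribʳ []      q       r = ≋-refl
mulP-distribʳ (a ∷ p) []      r = ≋-sym (addP-identityʳ _)
mulP-distribʳ (a ∷ p) (b ∷ q) r = begin
  scaleP (a xor b) r ⊞ (false ∷ (p ⊞ q) ⊠ r)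
    ≈⟨ addP-cong (scaleP-xor a b r) (∷-cong refl (mulP-distribʳ p q r)) ⟩
  (scaleP a r ⊞ scaleP b r) ⊞ ((false ∷ p ⊠ r) ⊞ (false ∷ q ⊠ r))
    ≈⟨ interchange (scaleP a r) (scaleP b r) _ _ ⟩
  (scaleP a r ⊞ (false ∷ p ⊠ r)) ⊞ (scaleP b r ⊞ (false ∷ q ⊠ r)) ∎
  where open SetoidReasoning ≋-setoid

mulP-scaleP : ∀ a p q → scaleP a p ⊠ q ≋ scaleP a (p ⊠ q)
mulP-scaleP false p q = ≋-trans (mulP-congˡ q (scaleP-false p)) (≋-sym (scaleP-false (p ⊠ q)))
mulP-scaleP true  p q = ≋-trans (mulP-congˡ q (scaleP-true p)) (≋-sym (scaleP-true (p ⊠ q)))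

false∷-⊠ : ∀ p q → (false ∷ p) ⊠ q ≋ false ∷ p ⊠ q
false∷-⊠ p q = addP-cong (scaleP-false q) ≋-refl

mulP-assoc : ∀ p q r → (p ⊠ q) ⊠ r ≋ p ⊠ (q ⊠ r)
mulP-assoc []      q r = ≋-refl
mulP-assoc (a ∷ p) q r = begin
  (scaleP a q ⊞ (false ∷ p ⊠ q)) ⊠ r      ≈⟨ mulP-distribʳ (scaleP a q) (false ∷ p ⊠ q) r ⟩
  scaleP a q ⊠ r ⊞ (false ∷ p ⊠ q) ⊠ r    ≈⟨ addP-cong (mulP-scaleP a q r) (false∷-⊠ (p ⊠ q) r) ⟩
  scaleP a (q ⊠ r) ⊞ (false ∷ (p ⊠ q) ⊠ r) ≈⟨ addP-cong ≋-refl (∷-cong refl (mulP-assoc p q r)) ⟩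
  scaleP a (q ⊠ r) ⊞ (false ∷ p ⊠ (q ⊠ r)) ∎
  where open SetoidReasoning ≋-setoid

mulP-cong : ∀ {p p' q q'} → p ≋ p' → q ≋ q' → p ⊠ q ≋ p' ⊠ q'
mulP-cong {p} {p'} {q} p≋p' q≋q' = ≋-trans (mulP-congˡ q p≋p') (mulP-congʳ p' q≋q')

polyCommutativeRing : CommutativeRing 0ℓ 0ℓ
polyCommutativeRing = record
  { Carrier = Poly ; _≈_ = _≋_ ; _+_ = _⊞_ ; _*_ = _⊠_ ; -_ = λ p → p ; 0# = [] ; 1# = true ∷ []
  ; isCommutativeRing = record
    { isRing = record
      { +-isAbelianGroup = record
        { isGroup = record
          { isMonoid = CommutativeMonoid.isMonoid addP-commutativeMonoid
          ; inverse  = addP-self , addP-self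
          ; ⁻¹-cong  = λ p≋q → p≋q }
        ; comm = addP-comm }
      ; *-cong     = mulP-cong
      ; *-assoc    = mulP-assoc
      ; *-identity = mulP-identityˡ , mulP-identityʳ
      ; distrib    = (λ p q r → ≋-trans (mulP-comm p (q ⊞ r))
                                  (≋-trans (mulP-distribʳ q r p) (addP-cong (mulP-comm q p) (mulP-comm r p))))
                   , (λ p q r → mulP-distribʳ q r p) }
    ; *-comm = mulP-comm } }

-- A zero test that recognises coefficients such as 1 + 1, so that the ring solver
-- also cancels in characteristic 2.
isZero? : ∀ p → Maybe ([] ≋ p)
isZero? []          = just ≋-refl
isZero? (true  ∷ p) = nothing
isZero? (false ∷ p) = Maybe.map (λ []≋p → ≋-trans []≋false∷[] (∷-cong refl []≋p)) (isZero? p)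

polyAlmostCommutativeRing : AlmostCommutativeRing 0ℓ 0ℓ
polyAlmostCommutativeRing = fromCommutativeRing polyCommutativeRing isZero?

open import Algebra.Properties.CommutativeSemigroup
  (CommutativeRing.*-commutativeSemigroup polyCommutativeRing)
  using () renaming (x∙yz≈y∙xz to ⊠-x∙yz≈y∙xz)

-- Laurent polynomials

X : ℕ → Poly
X n = shiftP n (true ∷ [])

shiftP-≋ : ∀ n p → shiftP n p ≋ X n ⊠ p
shiftP-≋ zero    p = ≋-sym (mulP-identityˡ p)
shiftP-≋ (suc n) p = ≋-trans (∷-cong refl (shiftP-≋ n p)) (≋-sym (false∷-⊠ (X n) p))

shiftP-+ : ∀ m n p → shiftP (m ℕ.+ n) p ≡ shiftP m (shiftP n p)
shiftP-+ zero    n p = refl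
shiftP-+ (suc m) n p = cong (false ∷_) (shiftP-+ m n p)

X-+ : ∀ m n → X (m ℕ.+ n) ≋ X m ⊠ X n
X-+ m n = ≋-trans (≡⇒≋ (shiftP-+ m n _)) (shiftP-≋ m (X n))

shiftP-cancel : ∀ n {p q} → shiftP n p ≋ shiftP n q → p ≋ q
shiftP-cancel zero    h = h
shiftP-cancel (suc n) h = shiftP-cancel n (pointwise λ i → coeff-≡ h (suc i))

X⊠-cancel : ∀ n {p q} → X n ⊠ p ≋ X n ⊠ q → p ≋ q
X⊠-cancel n {p} {q} h = shiftP-cancel n (≋-trans (shiftP-≋ n p) (≋-trans h (≋-sym (shiftP-≋ n q))))

infix 4 _≃_

-- _≈_ of Defs as a record (cf. _≋_), with the shifts written as products by X n.
record _≃_ (a b : Laurent) : Set where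
  constructor cross
  field cross-≋ : X (den b) ⊠ num a ≋ X (den a) ⊠ num b

≃⇒≈ : ∀ {a b} → a ≃ b → a ≈ b
≃⇒≈ {mkL m p} {mkL n q} (cross h) =
  coeff-≡ (≋-trans (shiftP-≋ n p) (≋-trans h (≋-sym (shiftP-≋ m q))))

≃-isEquivalence : IsEquivalence _≃_
≃-isEquivalence = record
  { refl  = cross ≋-refl
  ; sym   = λ (cross h) → cross (≋-sym h)
  ; trans = trans
  }
  where
  trans : ∀ {a b c} → a ≃ b → b ≃ c → a ≃ c
  trans {mkL m p} {mkL n q} {mkL l r} (cross h₁) (cross h₂) = cross (X⊠-cancel n (begin
    X n ⊠ (X l ⊠ p) ≈⟨ ⊠-x∙yz≈y∙xz (X n) (X l) p ⟩
    X l ⊠ (X n ⊠ p) ≈⟨ mulP-congʳ (X l) h₁ ⟩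
    X l ⊠ (X m ⊠ q) ≈⟨ ⊠-x∙yz≈y∙xz (X l) (X m) q ⟩
    X m ⊠ (X l ⊠ q) ≈⟨ mulP-congʳ (X m) h₂ ⟩
    X m ⊠ (X n ⊠ r) ≈⟨ ⊠-x∙yz≈y∙xz (X m) (X n) r ⟩
    X n ⊠ (X m ⊠ r) ∎))
    where open SetoidReasoning ≋-setoid

-- A Laurent polynomial presented as a quotient of polynomials, up to ≋;
-- such presentations compose, which reduces ring laws in K to ring laws in F₂[x].
record Fraction (a : Laurent) : Set where
  constructor fraction
  field
    denominator numerator : Poly
    denominator-≋ : X (den a) ≋ denominator
    numerator-≋   : num a ≋ numerator
open Fraction

infixl 6 _⊕ᶠ_
infixl 7 _⊛ᶠ_

⌜_⌝ : ∀ a → Fraction a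
⌜ a ⌝ = fraction (X (den a)) (num a) ≋-refl ≋-refl

_⊕ᶠ_ : ∀ {a b} → Fraction a → Fraction b → Fraction (a ⊕ b)
_⊕ᶠ_ {a} {b} (fraction d e d≋ e≋) (fraction d' e' d'≋ e'≋) =
  fraction (d ⊠ d') (d' ⊠ e ⊞ d ⊠ e')
    (≋-trans (X-+ (den a) (den b)) (mulP-cong d≋ d'≋))
    (addP-cong (≋-trans (shiftP-≋ (den b) (num a)) (mulP-cong d'≋ e≋))
               (≋-trans (shiftP-≋ (den a) (num b)) (mulP-cong d≋ e'≋)))

_⊛ᶠ_ : ∀ {a b} → Fraction a → Fraction b → Fraction (a ⊛ b)
_⊛ᶠ_ {a} {b} (fraction d e d≋ e≋) (fraction d' e' d'≋ e'≋) =
  fraction (d ⊠ d') (e ⊠ e') (≋-trans (X-+ (den a) (den b)) (mulP-cong d≋ d'≋)) (mulP-cong e≋ e'≋)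

≃-byFractions : ∀ {a b} (fa : Fraction a) (fb : Fraction b) →
  denominator fb ⊠ numerator fa ≋ denominator fa ⊠ numerator fb → a ≃ b
≃-byFractions fa fb h =
  cross (≋-trans (mulP-cong (denominator-≋ fb) (numerator-≋ fa))
        (≋-trans h (≋-sym (mulP-cong (denominator-≋ fa) (numerator-≋ fb)))))

⊕-cong : ∀ {a a' b b'} → a ≃ a' → b ≃ b' → a ⊕ b ≃ a' ⊕ b'
⊕-cong {a@(mkL m p)} {a'@(mkL m' p')} {b@(mkL n q)} {b'@(mkL n' q')} (cross h₁) (cross h₂) =
  ≃-byFractions (⌜ a ⌝ ⊕ᶠ ⌜ b ⌝) (⌜ a' ⌝ ⊕ᶠ ⌜ b' ⌝) (begin
    (X m' ⊠ X n') ⊠ (X n ⊠ p ⊞ X m ⊠ q)                    ≈⟨ expand (X m') (X n') (X m) (X n) p q ⟩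
    (X n' ⊠ X n) ⊠ (X m' ⊠ p) ⊞ (X m' ⊠ X m) ⊠ (X n' ⊠ q)  ≈⟨ addP-cong (mulP-congʳ (X n' ⊠ X n) h₁)
                                                                      (mulP-congʳ (X m' ⊠ X m) h₂) ⟩
    (X n' ⊠ X n) ⊠ (X m ⊠ p') ⊞ (X m' ⊠ X m) ⊠ (X n ⊠ q')  ≈⟨ collect (X m') (X n') (X m) (X n) p' q' ⟩
    (X m ⊠ X n) ⊠ (X n' ⊠ p' ⊞ X m' ⊠ q')                  ∎)
  where
  open SetoidReasoning ≋-setoid
  expand : ∀ d₁' d₂' d₁ d₂ n₁ n₂ →
    (d₁' ⊠ d₂') ⊠ (d₂ ⊠ n₁ ⊞ d₁ ⊠ n₂) ≋ (d₂' ⊠ d₂) ⊠ (d₁' ⊠ n₁) ⊞ (d₁' ⊠ d₁) ⊠ (d₂' ⊠ n₂)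
  expand = solve-∀ polyAlmostCommutativeRing
  collect : ∀ d₁' d₂' d₁ d₂ n₁ n₂ →
    (d₂' ⊠ d₂) ⊠ (d₁ ⊠ n₁) ⊞ (d₁' ⊠ d₁) ⊠ (d₂ ⊠ n₂) ≋ (d₁ ⊠ d₂) ⊠ (d₂' ⊠ n₁ ⊞ d₁' ⊠ n₂)
  collect = solve-∀ polyAlmostCommutativeRing

⊛-cong : ∀ {a a' b b'} → a ≃ a' → b ≃ b' → a ⊛ b ≃ a' ⊛ b'
⊛-cong {a@(mkL m p)} {a'@(mkL m' p')} {b@(mkL n q)} {b'@(mkL n' q')} (cross h₁) (cross h₂) =
  ≃-byFractions (⌜ a ⌝ ⊛ᶠ ⌜ b ⌝) (⌜ a' ⌝ ⊛ᶠ ⌜ b' ⌝) (begin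
    (X m' ⊠ X n') ⊠ (p ⊠ q)   ≈⟨ regroup (X m') (X n') p q ⟩
    (X m' ⊠ p) ⊠ (X n' ⊠ q)   ≈⟨ mulP-cong h₁ h₂ ⟩
    (X m ⊠ p') ⊠ (X n ⊠ q')   ≈⟨ ≋-sym (regroup (X m) (X n) p' q') ⟩
    (X m ⊠ X n) ⊠ (p' ⊠ q')   ∎)
  where
  open SetoidReasoning ≋-setoid
  regroup : ∀ d₁ d₂ n₁ n₂ → (d₁ ⊠ d₂) ⊠ (n₁ ⊠ n₂) ≋ (d₁ ⊠ n₁) ⊠ (d₂ ⊠ n₂)
  regroup = solve-∀ polyAlmostCommutativeRing

⊕-assoc : ∀ a b c → (a ⊕ b) ⊕ c ≃ a ⊕ (b ⊕ c)
⊕-assoc a b c = ≃-byFractions (⌜ a ⌝ ⊕ᶠ ⌜ b ⌝ ⊕ᶠ ⌜ c ⌝) (⌜ a ⌝ ⊕ᶠ (⌜ b ⌝ ⊕ᶠ ⌜ c ⌝))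
  (law (X (den a)) (X (den b)) (X (den c)) (num a) (num b) (num c))
  where
  law : ∀ d₁ d₂ d₃ n₁ n₂ n₃ →
    (d₁ ⊠ (d₂ ⊠ d₃)) ⊠ (d₃ ⊠ (d₂ ⊠ n₁ ⊞ d₁ ⊠ n₂) ⊞ (d₁ ⊠ d₂) ⊠ n₃)
    ≋ ((d₁ ⊠ d₂) ⊠ d₃) ⊠ ((d₂ ⊠ d₃) ⊠ n₁ ⊞ d₁ ⊠ (d₃ ⊠ n₂ ⊞ d₂ ⊠ n₃))
  law = solve-∀ polyAlmostCommutativeRing

⊕-comm : ∀ a b → a ⊕ b ≃ b ⊕ a
⊕-comm a b = ≃-byFractions (⌜ a ⌝ ⊕ᶠ ⌜ b ⌝) (⌜ b ⌝ ⊕ᶠ ⌜ a ⌝) (law (X (den a)) (X (den b)) (num a) (num b))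
  where
  law : ∀ d₁ d₂ n₁ n₂ → (d₂ ⊠ d₁) ⊠ (d₂ ⊠ n₁ ⊞ d₁ ⊠ n₂) ≋ (d₁ ⊠ d₂) ⊠ (d₁ ⊠ n₂ ⊞ d₂ ⊠ n₁)
  law = solve-∀ polyAlmostCommutativeRing

⊕-identityˡ : ∀ a → 0L ⊕ a ≃ a
⊕-identityˡ a = ≃-byFractions (⌜ 0L ⌝ ⊕ᶠ ⌜ a ⌝) ⌜ a ⌝ (law (X (den a)) (num a))
  where
  law : ∀ d₁ n₁ → d₁ ⊠ (d₁ ⊠ [] ⊞ (true ∷ []) ⊠ n₁) ≋ ((true ∷ []) ⊠ d₁) ⊠ n₁
  law = solve-∀ polyAlmostCommutativeRing

⊕-self : ∀ a → a ⊕ a ≃ 0L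
⊕-self a = cross (≋-trans (mulP-identityˡ (num (a ⊕ a)))
                 (≋-trans (addP-self (shiftP (den a) (num a))) (≋-sym (mulP-zeroʳ (X (den (a ⊕ a)))))))

⊛-assoc : ∀ a b c → (a ⊛ b) ⊛ c ≃ a ⊛ (b ⊛ c)
⊛-assoc a b c = ≃-byFractions (⌜ a ⌝ ⊛ᶠ ⌜ b ⌝ ⊛ᶠ ⌜ c ⌝) (⌜ a ⌝ ⊛ᶠ (⌜ b ⌝ ⊛ᶠ ⌜ c ⌝))
  (law (X (den a)) (X (den b)) (X (den c)) (num a) (num b) (num c))
  where
  law : ∀ d₁ d₂ d₃ n₁ n₂ n₃ → (d₁ ⊠ (d₂ ⊠ d₃)) ⊠ ((n₁ ⊠ n₂) ⊠ n₃) ≋ ((d₁ ⊠ d₂) ⊠ d₃) ⊠ (n₁ ⊠ (n₂ ⊠ n₃))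
  law = solve-∀ polyAlmostCommutativeRing

⊛-comm : ∀ a b → a ⊛ b ≃ b ⊛ a
⊛-comm a b = ≃-byFractions (⌜ a ⌝ ⊛ᶠ ⌜ b ⌝) (⌜ b ⌝ ⊛ᶠ ⌜ a ⌝) (law (X (den a)) (X (den b)) (num a) (num b))
  where
  law : ∀ d₁ d₂ n₁ n₂ → (d₂ ⊠ d₁) ⊠ (n₁ ⊠ n₂) ≋ (d₁ ⊠ d₂) ⊠ (n₂ ⊠ n₁)
  law = solve-∀ polyAlmostCommutativeRing

⊛-identityˡ : ∀ a → 1L ⊛ a ≃ a
⊛-identityˡ a = ≃-byFractions (⌜ 1L ⌝ ⊛ᶠ ⌜ a ⌝) ⌜ a ⌝ (law (X (den a)) (num a))
  where
  law : ∀ d₁ n₁ → d₁ ⊠ ((true ∷ []) ⊠ n₁) ≋ ((true ∷ []) ⊠ d₁) ⊠ n₁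
  law = solve-∀ polyAlmostCommutativeRing

⊛-distribʳ : ∀ a b c → (b ⊕ c) ⊛ a ≃ b ⊛ a ⊕ c ⊛ a
⊛-distribʳ a b c = ≃-byFractions ((⌜ b ⌝ ⊕ᶠ ⌜ c ⌝) ⊛ᶠ ⌜ a ⌝) (⌜ b ⌝ ⊛ᶠ ⌜ a ⌝ ⊕ᶠ ⌜ c ⌝ ⊛ᶠ ⌜ a ⌝)
  (law (X (den a)) (X (den b)) (X (den c)) (num a) (num b) (num c))
  where
  law : ∀ d₁ d₂ d₃ n₁ n₂ n₃ →
    ((d₂ ⊠ d₁) ⊠ (d₃ ⊠ d₁)) ⊠ ((d₃ ⊠ n₂ ⊞ d₂ ⊠ n₃) ⊠ n₁)
    ≋ ((d₂ ⊠ d₃) ⊠ d₁) ⊠ ((d₃ ⊠ d₁) ⊠ (n₂ ⊠ n₁) ⊞ (d₂ ⊠ d₁) ⊠ (n₃ ⊠ n₁))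
  law = solve-∀ polyAlmostCommutativeRing

laurentCommutativeRing : CommutativeRing 0ℓ 0ℓ
laurentCommutativeRing = record
  { Carrier = Laurent ; _≈_ = _≃_ ; _+_ = _⊕_ ; _*_ = _⊛_ ; -_ = λ a → a ; 0# = 0L ; 1# = 1L
  ; isCommutativeRing = record
    { isRing = record
      { +-isAbelianGroup = record
        { isGroup = record
          { isMonoid = record
            { isSemigroup = record
              { isMagma = record { isEquivalence = ≃-isEquivalence ; ∙-cong = ⊕-cong }
              ; assoc = ⊕-assoc }
            ; identity = ⊕-identityˡ , λ a → ≃-trans (⊕-comm a 0L) (⊕-identityˡ a) }
          ; inverse = ⊕-self , ⊕-self
          ; ⁻¹-cong = λ a≃b → a≃b }
        ; comm = ⊕-comm }
      ; *-cong = ⊛-cong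
      ; *-assoc = ⊛-assoc
      ; *-identity = ⊛-identityˡ , λ a → ≃-trans (⊛-comm a 1L) (⊛-identityˡ a)
      ; distrib = (λ a b c → ≃-trans (⊛-comm a (b ⊕ c))
                               (≃-trans (⊛-distribʳ a b c) (⊕-cong (⊛-comm b a) (⊛-comm c a))))
                , ⊛-distribʳ }
    ; *-comm = ⊛-comm } }
  where open IsEquivalence ≃-isEquivalence using () renaming (trans to ≃-trans)

laurentAlmostCommutativeRing : AlmostCommutativeRing 0ℓ 0ℓ
laurentAlmostCommutativeRing = fromCommutativeRing laurentCommutativeRing isZero?ᴸ
  where
  isZero?ᴸ : ∀ a → Maybe (0L ≃ a)
  isZero?ᴸ (mkL d p) = Maybe.map zero≃ (isZero? p)
    where
    zero≃ : [] ≋ p → 0L ≃ mkL d p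
    zero≃ []≋p = cross (≋-trans (mulP-zeroʳ (X d)) (≋-trans []≋p (≋-sym (mulP-identityˡ p))))

open CommutativeRing laurentCommutativeRing public
  using () renaming (refl to ≃-refl; sym to ≃-sym; trans to ≃-trans; setoid to ≃-setoid)

infix 8 _²
_² : Laurent → Laurent
a ² = a ⊛ a

²-⊕ : ∀ a b → (a ⊕ b) ² ≃ a ² ⊕ b ²
²-⊕ = frobenius
  where
  frobenius : ∀ a b → (a ⊕ b) ⊛ (a ⊕ b) ≃ a ⊛ a ⊕ b ⊛ b
  frobenius = solve-∀ laurentAlmostCommutativeRing

≡⇒≃ : ∀ {a b} → a ≡ b → a ≃ b
≡⇒≃ refl = ≃-refl

xpow-+ : ∀ m n → xpow m ⊛ xpow n ≃ xpow (m ℕ.+ n)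
xpow-+ m n = cross (mulP-congʳ (X 0) (≋-sym (X-+ m n)))

xpow-²² : ∀ m → xpow m ² ² ≃ xpow (4 * m)
xpow-²² m = ≃-trans (⊛-cong (xpow-+ m m) (xpow-+ m m))
           (≃-trans (xpow-+ (m ℕ.+ m) (m ℕ.+ m)) (≡⇒≃ (cong xpow (lemma m))))
  where
  lemma : ∀ m → (m ℕ.+ m) ℕ.+ (m ℕ.+ m) ≡ 4 * m
  lemma = ℕ-solve-∀

xinv-xpow : ∀ m n → xinv (m ℕ.+ n) ⊛ xpow n ≃ xinv m
xinv-xpow m n = cross (begin
  X m ⊠ ((true ∷ []) ⊠ X n)   ≈⟨ mulP-congʳ (X m) (mulP-identityˡ (X n)) ⟩
  X m ⊠ X n                   ≈⟨ ≋-sym (X-+ m n) ⟩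
  X (m ℕ.+ n)                 ≡⟨ cong X (≡.sym (ℕₚ.+-identityʳ (m ℕ.+ n))) ⟩
  X (m ℕ.+ n ℕ.+ 0)           ≈⟨ ≋-sym (mulP-identityʳ _) ⟩
  X (m ℕ.+ n ℕ.+ 0) ⊠ (true ∷ []) ∎)
  where open SetoidReasoning ≋-setoid

²²-⊕ : ∀ a b → (a ⊕ b) ² ² ≃ a ² ² ⊕ b ² ²
²²-⊕ a b = ≃-trans (⊛-cong (²-⊕ a b) (²-⊕ a b)) (²-⊕ (a ²) (b ²))

xpow-4*+ : ∀ m n → xpow (4 * m ℕ.+ n) ≃ xpow m ² ² ⊛ xpow n
xpow-4*+ m n = ≃-trans (≃-sym (xpow-+ (4 * m) n)) (⊛-cong (≃-sym (xpow-²² m)) ≃-refl)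

-- The exponents a_n and the polynomials Q_n

4^≡⇒aN≡ : ∀ n a → 4 ^ n ≡ a * 3 ℕ.+ 1 → aN n ≡ a
4^≡⇒aN≡ n a 4ⁿ≡ = begin
  (4 ^ n ∸ 1) / 3               ≡⟨ cong (λ m → (m ∸ 1) / 3) 4ⁿ≡ ⟩
  (a * 3 ℕ.+ 1 ∸ 1) / 3       ≡⟨ cong (_/ 3) (ℕₚ.m+n∸n≡m (a * 3) 1) ⟩
  a * 3 / 3                     ≡⟨ m*n/n≡m a 3 ⟩
  a                               ∎
  where open ≡.≡-Reasoning

4^-step : ∀ n a → 4 ^ n ≡ a * 3 ℕ.+ 1 → 4 ^ suc n ≡ (4 * a ℕ.+ 1) * 3 ℕ.+ 1
4^-step n a 4ⁿ≡ = ≡.trans (cong (4 *_) 4ⁿ≡) (lemma a)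
  where
  lemma : ∀ a → 4 * (a * 3 ℕ.+ 1) ≡ (4 * a ℕ.+ 1) * 3 ℕ.+ 1
  lemma = ℕ-solve-∀

4^≡aN*3+1 : ∀ n → 4 ^ n ≡ aN n * 3 ℕ.+ 1
4^≡aN*3+1 zero    = refl
4^≡aN*3+1 (suc n) =
  ≡.trans 4^suc≡ (cong (λ a → a * 3 ℕ.+ 1) (≡.sym (4^≡⇒aN≡ (suc n) (4 * aN n ℕ.+ 1) 4^suc≡)))
  where
  4^suc≡ : 4 ^ suc n ≡ (4 * aN n ℕ.+ 1) * 3 ℕ.+ 1
  4^suc≡ = 4^-step n (aN n) (4^≡aN*3+1 n)

aN-suc : ∀ n → aN (suc n) ≡ 4 * aN n ℕ.+ 1
aN-suc n = 4^≡⇒aN≡ (suc n) _ (4^-step n (aN n) (4^≡aN*3+1 n))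

Qsum-suc : ∀ n m → m ≤ n → Qsum (suc n) m ≃ Qsum n m ² ²
Qsum-suc n zero    _   = ≃-refl
Qsum-suc n (suc m) m<n = begin
  Qsum (suc n) m ⊕ xpow (e * 4 ^ (n ∸ m))     ≈⟨ ⊕-cong (Qsum-suc n m (ℕₚ.<⇒≤ m<n)) (≡⇒≃ (cong xpow exponent)) ⟩
  Qsum n m ² ² ⊕ xpow (4 * t)                  ≈⟨ ⊕-cong ≃-refl (≃-sym (xpow-²² t)) ⟩
  Qsum n m ² ² ⊕ xpow t ² ²                      ≈⟨ ≃-sym (²²-⊕ (Qsum n m) (xpow t)) ⟩
  (Qsum n m ⊕ xpow t) ² ²                        ∎
  where
  open SetoidReasoning ≃-setoid
  e t : ℕ
  e = aN (suc m) ℕ.+ 3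
  t = e * 4 ^ (n ∸ suc m)
  exponent : e * 4 ^ (n ∸ m) ≡ 4 * t
  exponent = ≡.trans (cong (λ k → e * 4 ^ k) (ℕₚ.+-∸-assoc 1 m<n)) (rearrange e (4 ^ (n ∸ suc m)))
    where
    rearrange : ∀ e p → e * (4 * p) ≡ 4 * (e * p)
    rearrange = ℕ-solve-∀

Q-suc : ∀ n → Q (suc n) ≃ Q n ² ² ⊕ xpow (aN n) ² ² ⊛ xpow 4
Q-suc n = ⊕-cong (Qsum-suc n n ℕₚ.≤-refl) (≃-trans (≡⇒≃ (cong xpow exponent)) (xpow-4*+ (aN n) 4))
  where
  exponent : (aN (suc n) ℕ.+ 3) * 4 ^ (n ∸ n) ≡ 4 * aN n ℕ.+ 4
  exponent = begin
    (aN (suc n) ℕ.+ 3) * 4 ^ (n ∸ n)   ≡⟨ cong₂ (λ a k → (a ℕ.+ 3) * 4 ^ k) (aN-suc n) (ℕₚ.n∸n≡0 n) ⟩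
    (4 * aN n ℕ.+ 1 ℕ.+ 3) * 1        ≡⟨ simplify (aN n) ⟩
    4 * aN n ℕ.+ 4                      ∎
    where
    open ≡.≡-Reasoning
    simplify : ∀ a → (4 * a ℕ.+ 1 ℕ.+ 3) * 1 ≡ 4 * a ℕ.+ 4
    simplify = ℕ-solve-∀

xpow-aN-suc : ∀ n → xpow (aN (suc n)) ≃ xpow (aN n) ² ² ⊛ xpow 1
xpow-aN-suc n = ≃-trans (≡⇒≃ (cong xpow (aN-suc n))) (xpow-4*+ (aN n) 1)

-- The algebra A as a K-module, and multiplication by y

infix 4 _≈A_
infixl 6 _+A_
infixl 7 _·_

_+A_ : A → A → A
_+A_ = addA

_·_ : Laurent → A → A
_·_ = scaleA

record _≈A_ (u v : A) : Set where
  constructor coordinatewise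
  field
    ≃-c0 : c0 u ≃ c0 v
    ≃-c1 : c1 u ≃ c1 v
    ≃-c2 : c2 u ≃ c2 v
    ≃-c3 : c3 u ≃ c3 v
open _≈A_

≈A-isEquivalence : IsEquivalence _≈A_
≈A-isEquivalence = record
  { refl  = coordinatewise ≃-refl ≃-refl ≃-refl ≃-refl
  ; sym   = λ (coordinatewise e₀ e₁ e₂ e₃) → coordinatewise (≃-sym e₀) (≃-sym e₁) (≃-sym e₂) (≃-sym e₃)
  ; trans = λ (coordinatewise e₀ e₁ e₂ e₃) (coordinatewise f₀ f₁ f₂ f₃) →
      coordinatewise (≃-trans e₀ f₀) (≃-trans e₁ f₁) (≃-trans e₂ f₂) (≃-trans e₃ f₃)
  }

≈A-setoid : Setoid 0ℓ 0ℓ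
≈A-setoid = record { isEquivalence = ≈A-isEquivalence }

open Setoid ≈A-setoid public using () renaming (refl to ≈A-refl; sym to ≈A-sym; trans to ≈A-trans)

≡⇒≈A : ∀ {u v} → u ≡ v → u ≈A v
≡⇒≈A refl = ≈A-refl

+A-cong : ∀ {u u' v v'} → u ≈A u' → v ≈A v' → u +A v ≈A u' +A v'
+A-cong (coordinatewise e₀ e₁ e₂ e₃) (coordinatewise f₀ f₁ f₂ f₃) =
  coordinatewise (⊕-cong e₀ f₀) (⊕-cong e₁ f₁) (⊕-cong e₂ f₂) (⊕-cong e₃ f₃)

·-cong : ∀ {s s' u u'} → s ≃ s' → u ≈A u' → s · u ≈A s' · u'
·-cong s≃s' (coordinatewise e₀ e₁ e₂ e₃) =
  coordinatewise (⊛-cong s≃s' e₀) (⊛-cong s≃s' e₁) (⊛-cong s≃s' e₂) (⊛-cong s≃s' e₃)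

+A-congˡ : ∀ u {v v'} → v ≈A v' → u +A v ≈A u +A v'
+A-congˡ u = +A-cong (≈A-refl {u})

·-congˡ : ∀ s {u u'} → u ≈A u' → s · u ≈A s · u'
·-congˡ s = ·-cong (≃-refl {s})

·-congʳ : ∀ u {s s'} → s ≃ s' → s · u ≈A s' · u
·-congʳ u s≃s' = ·-cong s≃s' (≈A-refl {u})

record IsLinear (f : A → A) : Set where
  field
    preserves-≈A : ∀ {u v} → u ≈A v → f u ≈A f v
    linear       : ∀ s t u w → f (s · u +A t · w) ≈A s · f u +A t · f w

id-isLinear : IsLinear (λ u → u)
id-isLinear = record { preserves-≈A = λ u≈v → u≈v ; linear = λ _ _ _ _ → ≈A-refl }

∘-isLinear : ∀ {f g} → IsLinear f → IsLinear g → IsLinear (λ u → f (g u))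
∘-isLinear {f} {g} f-lin g-lin = record
  { preserves-≈A = λ u≈v → F.preserves-≈A (G.preserves-≈A u≈v)
  ; linear       = λ s t u w → ≈A-trans (F.preserves-≈A (G.linear s t u w)) (F.linear s t (g u) (g w))
  }
  where
  module F = IsLinear f-lin
  module G = IsLinear g-lin

mulY-isLinear : IsLinear mulY
mulY-isLinear = record
  { preserves-≈A = λ (coordinatewise e₀ e₁ e₂ e₃) →
      coordinatewise (⊛-cong (≃-refl {xpow 4}) e₃) (⊕-cong e₀ (⊛-cong (≃-refl {xpow 1}) e₃)) e₁ e₂
  ; linear       = λ s t u w → coordinatewise
      (law₀ (xpow 4) s t (c3 u) (c3 w)) (law₁ (xpow 1) s t (c0 u) (c0 w) (c3 u) (c3 w)) ≃-refl ≃-refl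
  }
  where
  law₀ : ∀ x s t a b → x ⊛ (s ⊛ a ⊕ t ⊛ b) ≃ s ⊛ (x ⊛ a) ⊕ t ⊛ (x ⊛ b)
  law₀ = solve-∀ laurentAlmostCommutativeRing
  law₁ : ∀ x s t a b c d → (s ⊛ a ⊕ t ⊛ b) ⊕ x ⊛ (s ⊛ c ⊕ t ⊛ d) ≃ s ⊛ (a ⊕ x ⊛ c) ⊕ t ⊛ (b ⊕ x ⊛ d)
  law₁ = solve-∀ laurentAlmostCommutativeRing

mulY^ : ℕ → A → A
mulY^ n v = fold v mulY n

mulY^-isLinear : ∀ n → IsLinear (mulY^ n)
mulY^-isLinear zero    = id-isLinear
mulY^-isLinear (suc n) = ∘-isLinear mulY-isLinear (mulY^-isLinear n)

mulY^-+ : ∀ m n v → mulY^ (m ℕ.+ n) v ≡ mulY^ m (mulY^ n v)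
mulY^-+ m n v = fold-+ v mulY m

mulY^-comm : ∀ m n v → mulY^ m (mulY^ n v) ≡ mulY^ n (mulY^ m v)
mulY^-comm m n v =
  ≡.trans (≡.sym (mulY^-+ m n v)) (≡.trans (cong (λ k → mulY^ k v) (ℕₚ.+-comm m n)) (mulY^-+ n m v))

mulY^-2* : ∀ n v → mulY^ (2 * n) v ≡ mulY^ n (mulY^ n v)
mulY^-2* n v = ≡.trans (mulY^-+ n (n ℕ.+ 0) v) (cong (λ k → mulY^ n (mulY^ k v)) (ℕₚ.+-identityʳ n))

mulY^4 : ∀ v → mulY^ 4 v ≈A xpow 4 · v +A xpow 1 · mulY v
mulY^4 v = coordinatewise (law (xpow 4) (xpow 1) (c0 v) (c3 v)) ≃-refl ≃-refl ≃-refl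
  where
  law : ∀ x⁴ x a d → x⁴ ⊛ (a ⊕ x ⊛ d) ≃ x⁴ ⊛ a ⊕ x ⊛ (x⁴ ⊛ d)
  law = solve-∀ laurentAlmostCommutativeRing

cross-terms-cancel : ∀ s t u v w → s · (s · u +A t · v) +A t · (s · v +A t · w) ≈A s ² · u +A t ² · w
cross-terms-cancel s t u v w = coordinatewise (law s t (c0 u) (c0 v) (c0 w)) (law s t (c1 u) (c1 v) (c1 w))
                                              (law s t (c2 u) (c2 v) (c2 w)) (law s t (c3 u) (c3 v) (c3 w))
  where
  law : ∀ s t a b c → s ⊛ (s ⊛ a ⊕ t ⊛ b) ⊕ t ⊛ (s ⊛ b ⊕ t ⊛ c) ≃ (s ⊛ s) ⊛ a ⊕ (t ⊛ t) ⊛ c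
  law = solve-∀ laurentAlmostCommutativeRing

mulY^-double : ∀ N j s t → (∀ v → mulY^ N v ≈A s · v +A t · mulY^ j v) →
               ∀ v → mulY^ (2 * N) v ≈A s ² · v +A t ² · mulY^ (2 * j) v
mulY^-double N j s t hyp v = begin
  mulY^ (2 * N) v                                    ≡⟨ mulY^-2* N v ⟩
  F (F v)                                              ≈⟨ F.preserves-≈A (hyp v) ⟩
  F (s · v +A t · L v)                                 ≈⟨ F.linear s t v (L v) ⟩
  s · F v +A t · F (L v)                               ≡⟨ cong (λ w → s · F v +A t · w) (mulY^-comm N j v) ⟩
  s · F v +A t · L (F v)                               ≈⟨ +A-cong (·-congˡ s (hyp v)) (·-congˡ t (L.preserves-≈A (hyp v))) ⟩
  s · (s · v +A t · L v) +A t · L (s · v +A t · L v)   ≈⟨ +A-congˡ (s · (s · v +A t · L v)) (·-congˡ t (L.linear s t v (L v))) ⟩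
  s · (s · v +A t · L v) +A t · (s · L v +A t · L (L v)) ≈⟨ cross-terms-cancel s t v (L v) (L (L v)) ⟩
  s ² · v +A t ² · L (L v)                             ≡⟨ cong (λ w → s ² · v +A t ² · w) (≡.sym (mulY^-2* j v)) ⟩
  s ² · v +A t ² · mulY^ (2 * j) v                   ∎
  where
  open SetoidReasoning ≈A-setoid
  F L : A → A
  F = mulY^ N
  L = mulY^ j
  module F = IsLinear (mulY^-isLinear N)
  module L = IsLinear (mulY^-isLinear j)

collect : ∀ s t p q u w → s · u +A t · (p · u +A q · w) ≈A (s ⊕ t ⊛ p) · u +A (t ⊛ q) · w
collect s t p q u w = coordinatewise (law s t p q (c0 u) (c0 w)) (law s t p q (c1 u) (c1 w))
                                     (law s t p q (c2 u) (c2 w)) (law s t p q (c3 u) (c3 w))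
  where
  law : ∀ s t p q a b → s ⊛ a ⊕ t ⊛ (p ⊛ a ⊕ q ⊛ b) ≃ (s ⊕ t ⊛ p) ⊛ a ⊕ (t ⊛ q) ⊛ b
  law = solve-∀ laurentAlmostCommutativeRing

mulY^-4^ : ∀ n v → mulY^ (4 ^ n) v ≈A Q n · v +A xpow (aN n) · mulY v
mulY^-2*4^ : ∀ n v → mulY^ (2 * 4 ^ n) v ≈A Q n ² · v +A xpow (aN n) ² · mulY^ 2 v

mulY^-2*4^ n = mulY^-double (4 ^ n) 1 (Q n) (xpow (aN n)) (mulY^-4^ n)

mulY^-4^ zero    v = coordinatewise (law (c0 v) (c0 (mulY v))) (law (c1 v) (c1 (mulY v)))
                                    (law (c2 v) (c2 (mulY v))) (law (c3 v) (c3 (mulY v)))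
  where
  law : ∀ a b → b ≃ 0L ⊛ a ⊕ 1L ⊛ b
  law = solve-∀ laurentAlmostCommutativeRing
mulY^-4^ (suc n) v = begin
  mulY^ (4 ^ suc n) v                                 ≡⟨ cong (λ k → mulY^ k v) (4*≡2*2* (4 ^ n)) ⟩
  mulY^ (2 * (2 * 4 ^ n)) v                       ≈⟨ mulY^-double (2 * 4 ^ n) 2 (Q n ²) (xpow (aN n) ²) (mulY^-2*4^ n) v ⟩
  q · v +A c · mulY^ 4 v                              ≈⟨ +A-congˡ (q · v) (·-congˡ c (mulY^4 v)) ⟩
  q · v +A c · (xpow 4 · v +A xpow 1 · mulY v)        ≈⟨ collect q c (xpow 4) (xpow 1) v (mulY v) ⟩
  (q ⊕ c ⊛ xpow 4) · v +A (c ⊛ xpow 1) · mulY v       ≈⟨ +A-cong (·-congʳ v (≃-sym (Q-suc n)))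
                                                                  (·-congʳ (mulY v) (≃-sym (xpow-aN-suc n))) ⟩
  Q (suc n) · v +A xpow (aN (suc n)) · mulY v         ∎
  where
  open SetoidReasoning ≈A-setoid
  q c : Laurent
  q = Q n ² ²
  c = xpow (aN n) ² ²
  4*≡2*2* : ∀ m → 4 * m ≡ 2 * (2 * m)
  4*≡2*2* = ℕ-solve-∀

-- Powers of y and the trace

mulA-yA : ∀ b → mulA yA b ≈A mulY b
mulA-yA b = coordinatewise (law (c0 b) (c0 (mulY b)) (c0 (mulY^ 2 b)) (c0 (mulY^ 3 b)))
                           (law (c1 b) (c1 (mulY b)) (c1 (mulY^ 2 b)) (c1 (mulY^ 3 b)))
                           (law (c2 b) (c2 (mulY b)) (c2 (mulY^ 2 b)) (c2 (mulY^ 3 b)))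
                           (law (c3 b) (c3 (mulY b)) (c3 (mulY^ 2 b)) (c3 (mulY^ 3 b)))
  where
  law : ∀ a₀ a₁ a₂ a₃ → (0L ⊛ a₀ ⊕ 1L ⊛ a₁) ⊕ (0L ⊛ a₂ ⊕ 0L ⊛ a₃) ≃ a₁
  law = solve-∀ laurentAlmostCommutativeRing

mulY-mulA-yinvA : ∀ b → mulY (mulA yinvA b) ≈A b
mulY-mulA-yinvA b = begin
  mulY (mulA yinvA b)                                           ≈⟨ Y.preserves-≈A drop-zeros ⟩
  mulY (xinv 3 · b +A xinv 4 · mulY^ 3 b)                       ≈⟨ Y.linear (xinv 3) (xinv 4) b (mulY^ 3 b) ⟩
  xinv 3 · mulY b +A xinv 4 · mulY^ 4 b                         ≈⟨ +A-congˡ (xinv 3 · mulY b) (·-congˡ (xinv 4) (mulY^4 b)) ⟩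
  xinv 3 · mulY b +A xinv 4 · (xpow 4 · b +A xpow 1 · mulY b)   ≈⟨ collect′ ⟩
  (xinv 4 ⊛ xpow 4) · b +A (xinv 3 ⊕ xinv 4 ⊛ xpow 1) · mulY b  ≈⟨ +A-cong (·-congʳ b (xinv-xpow 0 4))
                                                                           (·-congʳ (mulY b) (⊕-cong (≃-refl {xinv 3}) (xinv-xpow 3 1))) ⟩
  1L · b +A (xinv 3 ⊕ xinv 3) · mulY b                          ≈⟨ +A-congˡ (1L · b) (·-congʳ (mulY b) (⊕-self (xinv 3))) ⟩
  1L · b +A 0L · mulY b                                         ≈⟨ unit ⟩
  b                                                             ∎
  where
  open SetoidReasoning ≈A-setoid
  module Y = IsLinear mulY-isLinear
  drop-zeros : mulA yinvA b ≈A xinv 3 · b +A xinv 4 · mulY^ 3 b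
  drop-zeros = coordinatewise (law (c0 b) (c0 (mulY b)) (c0 (mulY^ 2 b)) (c0 (mulY^ 3 b)))
                              (law (c1 b) (c1 (mulY b)) (c1 (mulY^ 2 b)) (c1 (mulY^ 3 b)))
                              (law (c2 b) (c2 (mulY b)) (c2 (mulY^ 2 b)) (c2 (mulY^ 3 b)))
                              (law (c3 b) (c3 (mulY b)) (c3 (mulY^ 2 b)) (c3 (mulY^ 3 b)))
    where
    law : ∀ a₀ a₁ a₂ a₃ → (xinv 3 ⊛ a₀ ⊕ 0L ⊛ a₁) ⊕ (0L ⊛ a₂ ⊕ xinv 4 ⊛ a₃) ≃ xinv 3 ⊛ a₀ ⊕ xinv 4 ⊛ a₃
    law = solve-∀ laurentAlmostCommutativeRing
  collect′ : xinv 3 · mulY b +A xinv 4 · (xpow 4 · b +A xpow 1 · mulY b)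
             ≈A (xinv 4 ⊛ xpow 4) · b +A (xinv 3 ⊕ xinv 4 ⊛ xpow 1) · mulY b
  collect′ = coordinatewise (law (c0 b) (c0 (mulY b))) (law (c1 b) (c1 (mulY b)))
                            (law (c2 b) (c2 (mulY b))) (law (c3 b) (c3 (mulY b)))
    where
    law : ∀ a m → xinv 3 ⊛ m ⊕ xinv 4 ⊛ (xpow 4 ⊛ a ⊕ xpow 1 ⊛ m) ≃ (xinv 4 ⊛ xpow 4) ⊛ a ⊕ (xinv 3 ⊕ xinv 4 ⊛ xpow 1) ⊛ m
    law = solve-∀ laurentAlmostCommutativeRing
  unit : 1L · b +A 0L · mulY b ≈A b
  unit = coordinatewise (law (c0 b) (c0 (mulY b))) (law (c1 b) (c1 (mulY b)))
                        (law (c2 b) (c2 (mulY b))) (law (c3 b) (c3 (mulY b)))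
    where
    law : ∀ a m → 1L ⊛ a ⊕ 0L ⊛ m ≃ a
    law = solve-∀ laurentAlmostCommutativeRing

ypow-suc : ∀ k → ypow (k + + 1) ≈A mulY (ypow k)
ypow-suc (+ n)           = ≈A-trans (≡⇒≈A (cong (powA yA) (ℕₚ.+-comm n 1))) (mulA-yA (powA yA n))
ypow-suc -[1+ zero ]     = ≈A-sym (mulY-mulA-yinvA oneA)
ypow-suc -[1+ suc n ]    = ≈A-sym (mulY-mulA-yinvA (powA yinvA (suc n)))

ypow-+ : ∀ k j → ypow (k + + j) ≈A mulY^ j (ypow k)
ypow-+ k zero    = ≡⇒≈A (cong ypow (ℤₚ.+-identityʳ k))
ypow-+ k (suc j) = begin
  ypow (k + + suc j)           ≡⟨ cong (λ m → ypow (k + + m)) (ℕₚ.+-comm 1 j) ⟩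
  ypow (k + (+ j + + 1))       ≡⟨ cong ypow (ℤₚ.+-assoc k (+ j) (+ 1)) ⟨
  ypow ((k + + j) + + 1)       ≈⟨ ypow-suc (k + + j) ⟩
  mulY (ypow (k + + j))        ≈⟨ IsLinear.preserves-≈A mulY-isLinear (ypow-+ k j) ⟩
  mulY (mulY^ j (ypow k))      ∎
  where open SetoidReasoning ≈A-setoid

mulA-isLinearˡ : ∀ b → IsLinear (λ u → mulA u b)
mulA-isLinearˡ b = record
  { preserves-≈A = λ (coordinatewise e₀ e₁ e₂ e₃) →
      +A-cong (+A-cong (·-congʳ b e₀) (·-congʳ (mulY b) e₁)) (+A-cong (·-congʳ (mulY^ 2 b) e₂) (·-congʳ (mulY^ 3 b) e₃))
  ; linear = λ s t u w → coordinatewise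
      (law s t (c0 u) (c1 u) (c2 u) (c3 u) (c0 w) (c1 w) (c2 w) (c3 w) (c0 b) (c0 (mulY b)) (c0 (mulY^ 2 b)) (c0 (mulY^ 3 b)))
      (law s t (c0 u) (c1 u) (c2 u) (c3 u) (c0 w) (c1 w) (c2 w) (c3 w) (c1 b) (c1 (mulY b)) (c1 (mulY^ 2 b)) (c1 (mulY^ 3 b)))
      (law s t (c0 u) (c1 u) (c2 u) (c3 u) (c0 w) (c1 w) (c2 w) (c3 w) (c2 b) (c2 (mulY b)) (c2 (mulY^ 2 b)) (c2 (mulY^ 3 b)))
      (law s t (c0 u) (c1 u) (c2 u) (c3 u) (c0 w) (c1 w) (c2 w) (c3 w) (c3 b) (c3 (mulY b)) (c3 (mulY^ 2 b)) (c3 (mulY^ 3 b)))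
  }
  where
  law : ∀ s t u₀ u₁ u₂ u₃ w₀ w₁ w₂ w₃ e₀ e₁ e₂ e₃ →
    ((s ⊛ u₀ ⊕ t ⊛ w₀) ⊛ e₀ ⊕ (s ⊛ u₁ ⊕ t ⊛ w₁) ⊛ e₁) ⊕ ((s ⊛ u₂ ⊕ t ⊛ w₂) ⊛ e₂ ⊕ (s ⊛ u₃ ⊕ t ⊛ w₃) ⊛ e₃)
    ≃ s ⊛ ((u₀ ⊛ e₀ ⊕ u₁ ⊛ e₁) ⊕ (u₂ ⊛ e₂ ⊕ u₃ ⊛ e₃)) ⊕ t ⊛ ((w₀ ⊛ e₀ ⊕ w₁ ⊛ e₁) ⊕ (w₂ ⊛ e₂ ⊕ w₃ ⊛ e₃))
  law = solve-∀ laurentAlmostCommutativeRing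

trA-cong : ∀ {u v} → u ≈A v → trA u ≃ trA v
trA-cong u≈v = ⊕-cong (⊕-cong (⊕-cong (≃-c0 u≈v) (≃-c1 (M.preserves-≈A yA u≈v)))
                               (≃-c2 (M.preserves-≈A (powA yA 2) u≈v)))
                      (≃-c3 (M.preserves-≈A (powA yA 3) u≈v))
  where module M b = IsLinear (mulA-isLinearˡ b)

trA-linear : ∀ s t u w → trA (s · u +A t · w) ≃ s ⊛ trA u ⊕ t ⊛ trA w
trA-linear s t u w = ≃-trans
  (⊕-cong (⊕-cong (⊕-cong (≃-refl {s ⊛ c0 u ⊕ t ⊛ c0 w}) (≃-c1 (M.linear yA s t u w)))
                  (≃-c2 (M.linear (powA yA 2) s t u w)))
          (≃-c3 (M.linear (powA yA 3) s t u w)))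
  (law s t (c0 u) (c1 (mulA u yA)) (c2 (mulA u (powA yA 2))) (c3 (mulA u (powA yA 3)))
           (c0 w) (c1 (mulA w yA)) (c2 (mulA w (powA yA 2))) (c3 (mulA w (powA yA 3))))
  where
  module M b = IsLinear (mulA-isLinearˡ b)
  law : ∀ s t a₀ a₁ a₂ a₃ b₀ b₁ b₂ b₃ →
    (((s ⊛ a₀ ⊕ t ⊛ b₀) ⊕ (s ⊛ a₁ ⊕ t ⊛ b₁)) ⊕ (s ⊛ a₂ ⊕ t ⊛ b₂)) ⊕ (s ⊛ a₃ ⊕ t ⊛ b₃)
    ≃ s ⊛ (((a₀ ⊕ a₁) ⊕ a₂) ⊕ a₃) ⊕ t ⊛ (((b₀ ⊕ b₁) ⊕ b₂) ⊕ b₃)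
  law = solve-∀ laurentAlmostCommutativeRing

P-shift : ∀ K j s t → (∀ v → mulY^ K v ≈A s · v +A t · mulY^ j v) →
          ∀ k → P (+ K + k) ≃ s ⊛ P k ⊕ t ⊛ P (k + + j)
P-shift K j s t hyp k = ≃-trans (trA-cong ypow-shift) (trA-linear s t (ypow k) (ypow (k + + j)))
  where
  ypow-shift : ypow (+ K + k) ≈A s · ypow k +A t · ypow (k + + j)
  ypow-shift = begin
    ypow (+ K + k)                          ≡⟨ cong ypow (ℤₚ.+-comm (+ K) k) ⟩
    ypow (k + + K)                          ≈⟨ ypow-+ k K ⟩
    mulY^ K (ypow k)                        ≈⟨ hyp (ypow k) ⟩
    s · ypow k +A t · mulY^ j (ypow k)      ≈⟨ +A-congˡ (s · ypow k) (·-congˡ t (≈A-sym (ypow-+ k j))) ⟩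
    s · ypow k +A t · ypow (k + + j)        ∎
    where open SetoidReasoning ≈A-setoid

xpow-² : ∀ m → xpow m ² ≃ xpow (2 * m)
xpow-² m = ≃-trans (xpow-+ m m) (≡⇒≃ (cong (λ k → xpow (m ℕ.+ k)) (≡.sym (ℕₚ.+-identityʳ m))))

mainTheorem18 : (n : ℕ) (k : ℤ) →
    (P (+ (4 ^ n) + k) ≈ Q n ⊛ P k ⊕ xpow (aN n) ⊛ P (k + + 1))
    × (P (+ (2 * 4 ^ n) + k) ≈ Q n ⊛ Q n ⊛ P k ⊕ xpow (2 * aN n) ⊛ P (k + + 2))
mainTheorem18 n k =
    ≃⇒≈ (P-shift (4 ^ n) 1 (Q n) (xpow (aN n)) (mulY^-4^ n) k)
  , ≃⇒≈ (≃-trans (P-shift (2 * 4 ^ n) 2 (Q n ²) (xpow (aN n) ²) (mulY^-2*4^ n) k)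
                 (⊕-cong (≃-refl {Q n ² ⊛ P k}) (⊛-cong (xpow-² (aN n)) (≃-refl {P (k + + 2)}))))
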